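{- Let $p$ be a prime and $X\subseteq\mathbb{Z}_p$. Then $X$ is a recognizable subset of the ring $\langle\mathbb{Z}_p;+,\times\rangle$ if and only if $X=F+p^n\mathbb{Z}_p$ for some $n\in\mathbb{N}$ and some subset $F$ of $\{0,\ldots,p^n-1\}$.
   Context: $\mathbb{Z}_p$ is the ring of $p$-adic integers (inverse limit of the rings $\mathbb{Z}/p^n\mathbb{Z}$), containing $\mathbb{N}$. $X\subseteq\mathbb{Z}_p$ is recognizable if there is a finite algebra $\langle M;\oplus,\otimes\rangle$ with two binary operations and a surjective morphism $\varphi:\langle\mathbb{Z}_p;+,\times\rangle\to\langle M;\oplus,\otimes\rangle$ with $X=\varphi^{ -1}(\varphi(X))$. -}

module Defs where

open import Data.Nat using (ℕ; zero; suc; _+_; _*_; _^_; _/_; NonZero)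
open import Data.Nat.DivMod using (_mod_)
open import Data.Nat.Properties using (m^n≢0)
open import Data.Fin using (Fin; toℕ)
open import Data.Product using (Σ; ∃; _×_)
open import Function.Bundles using (_⇔_)
open import Relation.Binary.PropositionalEquality using (_≡_)

-- The ring ℤ_p of p-adic integers, represented by p-adic digit expansions:
-- x = Σ_i (digit i) p^i.  This is in canonical bijection with the inverse
-- limit of the ℤ/p^nℤ (the n-th component is the value of the first n digits).
module _ (p : ℕ) .{{_ : NonZero p}} where

  Zp : Set
  Zp = ℕ → Fin p

  _≈_ : Zp → Zp → Set
  x ≈ y = ∀ i → x i ≡ y i

  -- value of the first n digits: the image of x in ℤ/p^nℤ, as a number < p^n
  val : ℕ → Zp → ℕ
  val zero    x = 0
  val (suc n) x = val n x + toℕ (x n) * p ^ n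

  digitOf : ℕ → ℕ → Fin p
  digitOf m n = (_/_ m (p ^ n) {{m^n≢0 p n}}) mod p

  ι : ℕ → Zp
  ι m = digitOf m

  _+ₚ_ : Zp → Zp → Zp
  (x +ₚ y) n = digitOf (val (suc n) x + val (suc n) y) n

  _*ₚ_ : Zp → Zp → Zp
  (x *ₚ y) n = digitOf (val (suc n) x * val (suc n) y) n

  -- X ⊆ ℤ_p is recognizable: there is a finite algebra ⟨M;⊕,⊗⟩ (M ≅ Fin k)
  -- and a surjective morphism φ : ⟨ℤ_p;+,×⟩ → ⟨M;⊕,⊗⟩ with X = φ⁻¹(φ(X)).
  record Recognizable (X : Zp → Set) : Set where
    field
      k    : ℕ
      _⊕_  : Fin k → Fin k → Fin k
      _⊗_  : Fin k → Fin k → Fin k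
      φ    : Zp → Fin k
      φ-wd : ∀ x y → x ≈ y → φ x ≡ φ y
      φ-+  : ∀ x y → φ (x +ₚ y) ≡ φ x ⊕ φ y
      φ-*  : ∀ x y → φ (x *ₚ y) ≡ φ x ⊗ φ y
      φ-surj : ∀ m → ∃ λ x → φ x ≡ m
      saturated : ∀ y → X y ⇔ (∃ λ x → X x × φ x ≡ φ y)

  IsFPlusPowIdeal : (X : Zp → Set) (n : ℕ) (F : Fin (p ^ n) → Set) → Set
  IsFPlusPowIdeal X n F =
    ∀ y → X y ⇔ (∃ λ f → F f × ∃ λ z → y ≈ (ι (toℕ f) +ₚ (ι (p ^ n) *ₚ z)))

module Submission where

-- A morphism φ from ℤₚ to a finite algebra identifies two naturals a and a + d (pigeonhole).
-- Write d = pᵉu with p ∤ u; then u is a unit of ℤₚ, so for every x with first e digits c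
-- there is an affine map t ↦ s + t·w sending a to c and a + d to x.  Since φ(s + t·w) depends
-- on t only through φ t, φ x = φ c: φ factors through reduction mod pᵉ, and a set X saturated
-- for φ is a union of residue classes mod pᵉ, i.e. X = F + pᵉℤₚ.  Conversely, reduction mod pⁿ
-- onto ℤ/pⁿ recognizes every union of residue classes mod pⁿ.

open import Defs
open import Data.Nat
open import Data.Nat.Properties
open import Data.Nat.DivMod
open import Data.Nat.Divisibility using (_∣_; divides; _∣?_; ∣-trans; n∣m*n; ∣1⇒≡1)
open import Data.Nat.Coprimality using (Coprime; coprime-Bézout; coprime-divisor)
open import Data.Nat.GCD using (module Bézout)
open import Data.Nat.Primality using (Prime; prime⇒irreducible; prime⇒nonTrivial)
open import Data.Nat.Induction using (<-rec)
open import Data.Nat.Solver using (module +-*-Solver)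
open import Data.Fin using (Fin; toℕ; fromℕ<)
open import Data.Fin.Properties using (toℕ-fromℕ<; toℕ-injective; toℕ<n; pigeonhole)
open import Data.Product using (Σ; ∃; ∃₂; _×_; _,_; proj₁; proj₂)
open import Data.Sum using (inj₁; inj₂)
open import Function.Bundles using (_⇔_; mk⇔; Equivalence)
open import Level using (0ℓ)
open import Relation.Binary.Bundles using (Setoid)
open import Relation.Binary.Structures using (IsEquivalence)
open import Relation.Nullary using (¬_; contradiction; yes; no)
open import Relation.Binary.PropositionalEquality
import Relation.Binary.Reasoning.Setoid as SetoidReasoning

open +-*-Solver using (solve; _:+_; _:*_; _:=_; con)

module Congruence (m : ℕ) .{{_ : NonZero m}} where

  infix 4 _≋_

  -- A record rather than the bare equation a % m ≡ b % m, so that a and b can be inferred.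
  record _≋_ (a b : ℕ) : Set where
    constructor mk≋
    field %-≡ : a % m ≡ b % m

  open _≋_ public

  ≋-isEquivalence : IsEquivalence _≋_
  ≋-isEquivalence = record
    { refl  = mk≋ refl
    ; sym   = λ (mk≋ e) → mk≋ (sym e)
    ; trans = λ (mk≋ e) (mk≋ f) → mk≋ (trans e f)
    }

  ≋-setoid : Setoid 0ℓ 0ℓ
  ≋-setoid = record { isEquivalence = ≋-isEquivalence }

  module ≋-Reasoning = SetoidReasoning ≋-setoid

  open IsEquivalence ≋-isEquivalence public
    using () renaming (refl to ≋-refl; sym to ≋-sym; trans to ≋-trans; reflexive to ≡⇒≋)

  %-≋ : ∀ a → a % m ≋ a
  %-≋ a = mk≋ (m%n%n≡m%n a m)

  +-≋ : ∀ {a b c d} → a ≋ b → c ≋ d → a + c ≋ b + d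
  +-≋ {a} {b} {c} {d} (mk≋ e) (mk≋ f) = mk≋ (begin
    (a + c) % m             ≡⟨ %-distribˡ-+ a c m ⟩
    (a % m + c % m) % m     ≡⟨ cong₂ (λ x y → (x + y) % m) e f ⟩
    (b % m + d % m) % m     ≡⟨ %-distribˡ-+ b d m ⟨
    (b + d) % m             ∎)
    where open ≡-Reasoning

  *-≋ : ∀ {a b c d} → a ≋ b → c ≋ d → a * c ≋ b * d
  *-≋ {a} {b} {c} {d} (mk≋ e) (mk≋ f) = mk≋ (begin
    (a * c) % m             ≡⟨ %-distribˡ-* a c m ⟩
    (a % m * (c % m)) % m   ≡⟨ cong₂ (λ x y → (x * y) % m) e f ⟩
    (b % m * (d % m)) % m   ≡⟨ %-distribˡ-* b d m ⟨
    (b * d) % m             ∎)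
    where open ≡-Reasoning

  +-*-≋ : ∀ a k → a + k * m ≋ a
  +-*-≋ a k = mk≋ ([m+kn]%n≡m%n a k m)

  ≋⇒≡ : ∀ {a b} → a < m → b < m → a ≋ b → a ≡ b
  ≋⇒≡ {a} {b} a<m b<m (mk≋ e) = trans (sym (m<n⇒m%n≡m a<m)) (trans e (m<n⇒m%n≡m b<m))

  inverse-unique : ∀ {u a b} → a * u ≋ 1 → b * u ≋ 1 → a ≋ b
  inverse-unique {u} {a} {b} au≋1 bu≋1 = begin
    a            ≡⟨ *-identityʳ a ⟨
    a * 1        ≈⟨ *-≋ (≋-refl {a}) bu≋1 ⟨
    a * (b * u)  ≡⟨ solve 3 (λ a b u → a :* (b :* u) := b :* (a :* u)) refl a b u ⟩
    b * (a * u)  ≈⟨ *-≋ (≋-refl {b}) au≋1 ⟩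
    b * 1        ≡⟨ *-identityʳ b ⟩
    b            ∎
    where open ≋-Reasoning

  coprime⇒inverse : ∀ {u} → Coprime u m → ∃ λ v → v * u ≋ 1
  coprime⇒inverse {u} c with coprime-Bézout c
  ... | Bézout.+- x y 1+ym≡xu = x , (begin
    x * u        ≡⟨ 1+ym≡xu ⟨
    1 + y * m    ≈⟨ +-*-≋ 1 y ⟩
    1            ∎)
    where open ≋-Reasoning
  ... | Bézout.-+ x y 1+xu≡ym = pred m * x , (begin
    pred m * x * u                        ≡⟨ *-assoc (pred m) x u ⟩
    pred m * (x * u)                      ≈⟨ +-*-≋ _ 1 ⟨
    pred m * (x * u) + 1 * m              ≡⟨ cong (λ t → pred m * (x * u) + 1 * t) (suc-pred m) ⟨
    pred m * (x * u) + 1 * suc (pred m)   ≡⟨ solve 2 (λ q a → q :* a :+ con 1 :* (con 1 :+ q) := con 1 :+ q :* (con 1 :+ a))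
                                                     refl (pred m) (x * u) ⟩
    1 + pred m * (1 + x * u)              ≡⟨ cong (λ t → 1 + pred m * t) 1+xu≡ym ⟩
    1 + pred m * (y * m)                  ≡⟨ cong (1 +_) (*-assoc (pred m) y m) ⟨
    1 + pred m * y * m                    ≈⟨ +-*-≋ 1 (pred m * y) ⟩
    1                                     ∎)
    where open ≋-Reasoning

%-weaken : ∀ m n {a b} .{{_ : NonZero m}} .{{_ : NonZero n}} → m ∣ n → a % n ≡ b % n → a % m ≡ b % m
%-weaken m n {a} {b} m∣n e = begin
  a % m       ≡⟨ m∣n⇒o%n%m≡o%m m n a m∣n ⟨
  a % n % m   ≡⟨ cong (_% m) e ⟩
  b % n % m   ≡⟨ m∣n⇒o%n%m≡o%m m n b m∣n ⟩
  b % m       ∎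
  where open ≡-Reasoning

coprime-^ : ∀ {u p} → Coprime u p → ∀ n → Coprime u (p ^ n)
coprime-^ c zero    (_ , d∣1)       = ∣1⇒≡1 d∣1
coprime-^ c (suc n) (d∣u , d∣p*pⁿ) = coprime-^ c n (d∣u , coprime-divisor d⊥p d∣p*pⁿ)
  where
  d⊥p : Coprime _ _
  d⊥p (e∣d , e∣p) = c (∣-trans e∣d d∣u , e∣p)

prime∤⇒coprime : ∀ {p u} → Prime p → ¬ p ∣ u → Coprime u p
prime∤⇒coprime p-prime p∤u (d∣u , d∣p) with prime⇒irreducible p-prime d∣p
... | inj₁ d≡1    = d≡1
... | inj₂ refl   = contradiction d∣u p∤u

p-adic-decomposition : ∀ {p} → 1 < p → ∀ d → 0 < d → ∃₂ λ e u → d ≡ p ^ e * u × ¬ p ∣ u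
p-adic-decomposition {p} 1<p = <-rec _ go
  where
  go : ∀ d → (∀ {d′} → d′ < d → 0 < d′ → ∃₂ λ e u → d′ ≡ p ^ e * u × ¬ p ∣ u) →
       0 < d → ∃₂ λ e u → d ≡ p ^ e * u × ¬ p ∣ u
  go d rec 0<d with p ∣? d
  ... | no p∤d = 0 , d , sym (+-identityʳ d) , p∤d
  ... | yes (divides zero d≡0) = contradiction (subst (0 <_) d≡0 0<d) λ ()
  ... | yes (divides q@(suc _) d≡q*p) with rec (subst (q <_) (sym d≡q*p) (m<m*n q p 1<p)) z<s
  ...   | e , u , q≡pᵉu , p∤u = suc e , u , (begin
    d               ≡⟨ d≡q*p ⟩
    q * p           ≡⟨ cong (_* p) q≡pᵉu ⟩
    p ^ e * u * p   ≡⟨ solve 3 (λ x u p → x :* u :* p := p :* x :* u) refl (p ^ e) u p ⟩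
    p ^ suc e * u   ∎) , p∤u
    where open ≡-Reasoning

m%[n*o]≡m%o+m/o%n*o : ∀ m n o .{{_ : NonZero n}} .{{_ : NonZero o}} → {{_ : NonZero (n * o)}} →
                      m % (n * o) ≡ m % o + m / o % n * o
m%[n*o]≡m%o+m/o%n*o m n o = begin
  r                      ≡⟨ m≡m%n+[m/n]*n r o ⟩
  r % o + r / o * o      ≡⟨ cong₂ (λ a b → a + b * o) (m∣n⇒o%n%m≡o%m o (n * o) m (n∣m*n n))
                                                     (m%[n*o]/o≡m/o%n m n o) ⟩
  m % o + m / o % n * o  ∎
  where
  open ≡-Reasoning
  r = m % (n * o)

module PAdic (p : ℕ) .{{_ : NonZero p}} where

  module Mod (n : ℕ) = Congruence (p ^ n) {{m^n≢0 p n}}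

  infix  4 _≃_ _≋[_]_
  infixl 6 _⊞_
  infixl 7 _⊠_
  infix  8 _↾_

  -- congruence modulo p ^ n, not modulo n
  _≋[_]_ : ℕ → ℕ → ℕ → Set
  a ≋[ n ] b = Mod._≋_ n a b

  ℤₚ : Set
  ℤₚ = Zp p

  _≃_ : ℤₚ → ℤₚ → Set
  _≃_ = _≈_ p

  _⊞_ : ℤₚ → ℤₚ → ℤₚ
  _⊞_ = _+ₚ_ p

  _⊠_ : ℤₚ → ℤₚ → ℤₚ
  _⊠_ = _*ₚ_ p

  ⟦_⟧ : ℕ → ℤₚ
  ⟦_⟧ = ι p

  _↾_ : ℤₚ → ℕ → ℕ
  x ↾ n = val p n x

  ↾-< : ∀ n x → x ↾ n < p ^ n
  ↾-< zero    x = z<s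
  ↾-< (suc n) x = begin-strict
    x ↾ n + toℕ (x n) * p ^ n   <⟨ +-monoˡ-< _ (↾-< n x) ⟩
    suc (toℕ (x n)) * p ^ n     ≤⟨ *-monoˡ-≤ (p ^ n) (toℕ<n (x n)) ⟩
    p ^ suc n                   ∎
    where open ≤-Reasoning

  ↾-cong : ∀ {x y} → x ≃ y → ∀ n → x ↾ n ≡ y ↾ n
  ↾-cong x≃y zero    = refl
  ↾-cong x≃y (suc n) = cong₂ (λ a d → a + toℕ d * p ^ n) (↾-cong x≃y n) (x≃y n)

  ↾-injective : ∀ {x y} → (∀ n → x ↾ n ≡ y ↾ n) → x ≃ y
  ↾-injective {x} {y} eq i = toℕ-injective (*-cancelʳ-≡ _ _ (p ^ i) {{m^n≢0 p i}}
    (+-cancelˡ-≡ (x ↾ i) _ _ (trans (eq (suc i)) (cong (_+ toℕ (y i) * p ^ i) (sym (eq i))))))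

  ↾-≋-injective : ∀ {x y} → (∀ n → x ↾ n ≋[ n ] y ↾ n) → x ≃ y
  ↾-≋-injective {x} {y} eq = ↾-injective λ n → Mod.≋⇒≡ n (↾-< n x) (↾-< n y) (eq n)

  ↾-suc-≋ : ∀ n x → x ↾ suc n ≋[ n ] x ↾ n
  ↾-suc-≋ n x = Mod.+-*-≋ n (x ↾ n) (toℕ (x n))

  Coherent : (ℕ → ℕ) → Set
  Coherent g = ∀ n → g (suc n) ≋[ n ] g n

  limit : (ℕ → ℕ) → ℤₚ
  limit g i = digitOf p (g (suc i)) i

  limit-↾ : ∀ {g} → Coherent g → ∀ n → limit g ↾ n ≋[ n ] g n
  limit-↾ {g} coh zero    = Mod.mk≋ {0} (sym (n%1≡0 (g zero)))
  limit-↾ {g} coh (suc n) = ≋-trans (≡⇒≋ split) (%-≋ G)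
    where
    open Mod (suc n)
    instance
      _ = m^n≢0 p n
      _ = m^n≢0 p (suc n)
    G = g (suc n)
    low : limit g ↾ n ≡ G % p ^ n
    low = trans (sym (m<n⇒m%n≡m (↾-< n (limit g))))
                (Mod.%-≡ {n} (Mod.≋-trans n (limit-↾ coh n) (Mod.≋-sym n (coh n))))
    split : limit g ↾ suc n ≡ G % p ^ suc n
    split = begin
      limit g ↾ n + toℕ (limit g n) * p ^ n  ≡⟨ cong₂ (λ a b → a + b * p ^ n) low
                                                        (toℕ-fromℕ< (m%n<n (G / p ^ n) p)) ⟩
      G % p ^ n + G / p ^ n % p * p ^ n      ≡⟨ m%[n*o]≡m%o+m/o%n*o G p (p ^ n) ⟨
      G % p ^ suc n                          ∎
      where open ≡-Reasoning

  ⟦⟧-↾ : ∀ n m → ⟦ m ⟧ ↾ n ≋[ n ] m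
  ⟦⟧-↾ n m = limit-↾ {λ _ → m} (λ k → Mod.≋-refl k) n

  ↾-coherent₂ : (_∙_ : ℕ → ℕ → ℕ) →
                (∀ n {a b c d} → a ≋[ n ] b → c ≋[ n ] d → a ∙ c ≋[ n ] b ∙ d) →
                ∀ x y → Coherent (λ n → (x ↾ n) ∙ (y ↾ n))
  ↾-coherent₂ _∙_ ∙-≋ x y n = ∙-≋ n (↾-suc-≋ n x) (↾-suc-≋ n y)

  ⊞-↾ : ∀ n x y → (x ⊞ y) ↾ n ≋[ n ] x ↾ n + y ↾ n
  ⊞-↾ n x y = limit-↾ (↾-coherent₂ _+_ Mod.+-≋ x y) n

  ⊠-↾ : ∀ n x y → (x ⊠ y) ↾ n ≋[ n ] x ↾ n * y ↾ n
  ⊠-↾ n x y = limit-↾ (↾-coherent₂ _*_ Mod.*-≋ x y) n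

  ⊞⟦⟧⊠-↾ : ∀ n s m z → (s ⊞ ⟦ m ⟧ ⊠ z) ↾ n ≋[ n ] s ↾ n + m * z ↾ n
  ⊞⟦⟧⊠-↾ n s m z = begin
    (s ⊞ ⟦ m ⟧ ⊠ z) ↾ n             ≈⟨ ⊞-↾ n s (⟦ m ⟧ ⊠ z) ⟩
    s ↾ n + (⟦ m ⟧ ⊠ z) ↾ n         ≈⟨ +-≋ (≋-refl {s ↾ n}) (⊠-↾ n ⟦ m ⟧ z) ⟩
    s ↾ n + ⟦ m ⟧ ↾ n * z ↾ n       ≈⟨ +-≋ (≋-refl {s ↾ n}) (*-≋ (⟦⟧-↾ n m) (≋-refl {z ↾ n})) ⟩
    s ↾ n + m * z ↾ n               ∎
    where
    open Mod n
    open ≋-Reasoning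

  pred[p]<p : pred p < p
  pred[p]<p = subst (pred p <_) (suc-pred p) ≤-refl

  -1ₚ : ℤₚ
  -1ₚ _ = fromℕ< pred[p]<p

  -1ₚ-↾ : ∀ n → -1ₚ ↾ n + 1 ≡ p ^ n
  -1ₚ-↾ zero    = refl
  -1ₚ-↾ (suc n) = begin
    -1ₚ ↾ n + toℕ (-1ₚ n) * p ^ n + 1   ≡⟨ cong (λ t → -1ₚ ↾ n + t * p ^ n + 1) (toℕ-fromℕ< pred[p]<p) ⟩
    -1ₚ ↾ n + pred p * p ^ n + 1        ≡⟨ solve 3 (λ a b c → a :+ b :* c :+ con 1 := a :+ con 1 :+ b :* c)
                                                   refl (-1ₚ ↾ n) (pred p) (p ^ n) ⟩
    -1ₚ ↾ n + 1 + pred p * p ^ n        ≡⟨ cong (_+ pred p * p ^ n) (-1ₚ-↾ n) ⟩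
    suc (pred p) * p ^ n                ≡⟨ cong (_* p ^ n) (suc-pred p) ⟩
    p ^ suc n                           ∎
    where open ≡-Reasoning

  shift : ℕ → ℤₚ → ℤₚ
  shift n y i = y (n + i)

  ↾-+ : ∀ n N y → y ↾ (n + N) ≡ y ↾ n + p ^ n * shift n y ↾ N
  ↾-+ n zero    y = begin
    y ↾ (n + 0)                 ≡⟨ cong (y ↾_) (+-identityʳ n) ⟩
    y ↾ n                       ≡⟨ +-identityʳ (y ↾ n) ⟨
    y ↾ n + 0                   ≡⟨ cong (y ↾ n +_) (*-zeroʳ (p ^ n)) ⟨
    y ↾ n + p ^ n * 0           ∎
    where open ≡-Reasoning
  ↾-+ n (suc N) y = begin
    y ↾ (n + suc N)
      ≡⟨ cong (y ↾_) (+-suc n N) ⟩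
    y ↾ (n + N) + toℕ (y (n + N)) * p ^ (n + N)
      ≡⟨ cong₂ (λ s t → s + toℕ (y (n + N)) * t) (↾-+ n N y) (^-distribˡ-+-* p n N) ⟩
    y ↾ n + p ^ n * shift n y ↾ N + toℕ (y (n + N)) * (p ^ n * p ^ N)
      ≡⟨ solve 5 (λ a b c d e → a :+ b :* c :+ d :* (b :* e) := a :+ b :* (c :+ d :* e))
                 refl (y ↾ n) (p ^ n) (shift n y ↾ N) (toℕ (y (n + N))) (p ^ N) ⟩
    y ↾ n + p ^ n * shift n y ↾ suc N
      ∎
    where open ≡-Reasoning

  ↾-+-≋ : ∀ n N y → y ↾ (n + N) ≋[ n ] y ↾ n
  ↾-+-≋ n N y = begin
    y ↾ (n + N)                    ≡⟨ ↾-+ n N y ⟩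
    y ↾ n + p ^ n * shift n y ↾ N  ≡⟨ cong (y ↾ n +_) (*-comm (p ^ n) _) ⟩
    y ↾ n + shift n y ↾ N * p ^ n  ≈⟨ +-*-≋ (y ↾ n) (shift n y ↾ N) ⟩
    y ↾ n                          ∎
    where
    open Mod n
    open ≋-Reasoning

  expand : ∀ n y → y ≃ ⟦ y ↾ n ⟧ ⊞ ⟦ p ^ n ⟧ ⊠ shift n y
  expand n y = ↾-≋-injective {y} {⟦ y ↾ n ⟧ ⊞ ⟦ p ^ n ⟧ ⊠ shift n y} agree
    where
    agree : ∀ N → y ↾ N ≋[ N ] (⟦ y ↾ n ⟧ ⊞ ⟦ p ^ n ⟧ ⊠ shift n y) ↾ N
    agree N = begin
      y ↾ N                                  ≈⟨ ↾-+-≋ N n y ⟨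
      y ↾ (N + n)                            ≡⟨ cong (y ↾_) (+-comm N n) ⟩
      y ↾ (n + N)                            ≡⟨ ↾-+ n N y ⟩
      y ↾ n + p ^ n * shift n y ↾ N          ≈⟨ +-≋ (⟦⟧-↾ N (y ↾ n)) (≋-refl {p ^ n * shift n y ↾ N}) ⟨
      ⟦ y ↾ n ⟧ ↾ N + p ^ n * shift n y ↾ N  ≈⟨ ⊞⟦⟧⊠-↾ N ⟦ y ↾ n ⟧ (p ^ n) (shift n y) ⟨
      (⟦ y ↾ n ⟧ ⊞ ⟦ p ^ n ⟧ ⊠ shift n y) ↾ N ∎
      where
      open Mod N
      open ≋-Reasoning

  expand-↾ : ∀ n y {t} → y ↾ n ≡ t → y ≃ ⟦ t ⟧ ⊞ ⟦ p ^ n ⟧ ⊠ shift n y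
  expand-↾ n y y↾n≡t = subst (λ t → y ≃ ⟦ t ⟧ ⊞ ⟦ p ^ n ⟧ ⊠ shift n y) y↾n≡t (expand n y)

  ⟦⟧-↾-< : ∀ n {t} → t < p ^ n → ⟦ t ⟧ ↾ n ≡ t
  ⟦⟧-↾-< n {t} t< = Mod.≋⇒≡ n (↾-< n ⟦ t ⟧) t< (⟦⟧-↾ n t)

  ⟦⟧⊞⟦p^n⟧⊠-↾ : ∀ n {t} z → t < p ^ n → (⟦ t ⟧ ⊞ ⟦ p ^ n ⟧ ⊠ z) ↾ n ≡ t
  ⟦⟧⊞⟦p^n⟧⊠-↾ n {t} z t< = Mod.≋⇒≡ n (↾-< n _) t< (begin
    (⟦ t ⟧ ⊞ ⟦ p ^ n ⟧ ⊠ z) ↾ n    ≈⟨ ⊞⟦⟧⊠-↾ n ⟦ t ⟧ (p ^ n) z ⟩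
    ⟦ t ⟧ ↾ n + p ^ n * z ↾ n      ≡⟨ cong₂ _+_ (⟦⟧-↾-< n t<) (*-comm (p ^ n) (z ↾ n)) ⟩
    t + z ↾ n * p ^ n              ≈⟨ +-*-≋ t (z ↾ n) ⟩
    t                              ∎)
    where
    open Mod n
    open ≋-Reasoning

  ↾-≃-expansion : ∀ n y (f : Fin (p ^ n)) z → y ≃ ⟦ toℕ f ⟧ ⊞ ⟦ p ^ n ⟧ ⊠ z → y ↾ n ≡ toℕ f
  ↾-≃-expansion n y f z y≃ = trans (↾-cong y≃ n) (⟦⟧⊞⟦p^n⟧⊠-↾ n z (toℕ<n f))

  ≋[suc]⇒≋ : ∀ {n a b} → a ≋[ suc n ] b → a ≋[ n ] b
  ≋[suc]⇒≋ {n} e = Mod.mk≋ {n} (%-weaken (p ^ n) (p ^ suc n) (n∣m*n p) (Mod.%-≡ {suc n} e))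
    where
    instance
      _ = m^n≢0 p n
      _ = m^n≢0 p (suc n)

  unit-inverse : ∀ {u} → Coprime u p → Σ ℤₚ λ v → ∀ n → v ↾ n * u ≋[ n ] 1
  unit-inverse {u} u⊥p = limit g , λ n →
    Mod.≋-trans n (Mod.*-≋ n (limit-↾ coherent n) (Mod.≋-refl n)) (inverse-mod n .proj₂)
    where
    inverse-mod : ∀ n → ∃ λ v → v * u ≋[ n ] 1
    inverse-mod n = Mod.coprime⇒inverse n (coprime-^ u⊥p n)
    g : ℕ → ℕ
    g n = inverse-mod n .proj₁
    coherent : Coherent g
    coherent n = Mod.inverse-unique n (≋[suc]⇒≋ {n} (inverse-mod (suc n) .proj₂)) (inverse-mod n .proj₂)

  affine-pair : ∀ {u v} → (∀ n → v ↾ n * u ≋[ n ] 1) → ∀ e a c q →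
                ∃₂ λ s w → ⟦ c ⟧ ≃ s ⊞ ⟦ a ⟧ ⊠ w
                         × ⟦ c ⟧ ⊞ ⟦ p ^ e ⟧ ⊠ q ≃ s ⊞ ⟦ a + p ^ e * u ⟧ ⊠ w
  affine-pair {u} {v} v⁻¹ e a c q =
    s , w , ↾-≋-injective (λ n → Mod.≋-sym n (at-a n)) , ↾-≋-injective (λ n → Mod.≋-sym n (at-a+d n))
    where
    -- w = q / u and s = c − a·w, so that t ↦ s + t·w sends a to c and a + pᵉu to c + pᵉq.
    w = v ⊠ q
    s = ⟦ c ⟧ ⊞ ⟦ a ⟧ ⊠ (-1ₚ ⊠ w)

    s⊞⟦b⟧⊠w-↾ : ∀ n b → (s ⊞ ⟦ b ⟧ ⊠ w) ↾ n ≋[ n ] ⟦ c ⟧ ↾ n + a * (-1ₚ ↾ n * w ↾ n) + b * w ↾ n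
    s⊞⟦b⟧⊠w-↾ n b = begin
      (s ⊞ ⟦ b ⟧ ⊠ w) ↾ n
        ≈⟨ ⊞⟦⟧⊠-↾ n s b w ⟩
      s ↾ n + b * w ↾ n
        ≈⟨ +-≋ (⊞⟦⟧⊠-↾ n ⟦ c ⟧ a (-1ₚ ⊠ w)) (≋-refl {b * w ↾ n}) ⟩
      ⟦ c ⟧ ↾ n + a * (-1ₚ ⊠ w) ↾ n + b * w ↾ n
        ≈⟨ +-≋ (+-≋ (≋-refl {⟦ c ⟧ ↾ n}) (*-≋ (≋-refl {a}) (⊠-↾ n -1ₚ w))) (≋-refl {b * w ↾ n}) ⟩
      ⟦ c ⟧ ↾ n + a * (-1ₚ ↾ n * w ↾ n) + b * w ↾ n
        ∎
      where
      open Mod n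
      open ≋-Reasoning

    at-a : ∀ n → (s ⊞ ⟦ a ⟧ ⊠ w) ↾ n ≋[ n ] ⟦ c ⟧ ↾ n
    at-a n = begin
      (s ⊞ ⟦ a ⟧ ⊠ w) ↾ n       ≈⟨ s⊞⟦b⟧⊠w-↾ n a ⟩
      C + a * (M * W) + a * W   ≡⟨ solve 4 (λ C a M W → C :+ a :* (M :* W) :+ a :* W := C :+ a :* W :* (M :+ con 1))
                                           refl C a M W ⟩
      C + a * W * (M + 1)       ≡⟨ cong (λ t → C + a * W * t) (-1ₚ-↾ n) ⟩
      C + a * W * p ^ n         ≈⟨ +-*-≋ C (a * W) ⟩
      C                         ∎
      where
      open Mod n
      open ≋-Reasoning
      C = ⟦ c ⟧ ↾ n
      M = -1ₚ ↾ n
      W = w ↾ n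

    at-a+d : ∀ n → (s ⊞ ⟦ a + p ^ e * u ⟧ ⊠ w) ↾ n ≋[ n ] (⟦ c ⟧ ⊞ ⟦ p ^ e ⟧ ⊠ q) ↾ n
    at-a+d n = begin
      (s ⊞ ⟦ a + d ⟧ ⊠ w) ↾ n
        ≈⟨ s⊞⟦b⟧⊠w-↾ n (a + d) ⟩
      C + a * (M * W) + (a + d) * W
        ≡⟨ solve 5 (λ C a M W d → C :+ a :* (M :* W) :+ (a :+ d) :* W := (C :+ a :* (M :* W) :+ a :* W) :+ d :* W)
                   refl C a M W d ⟩
      (C + a * (M * W) + a * W) + d * W
        ≈⟨ +-≋ (≋-trans (≋-sym (s⊞⟦b⟧⊠w-↾ n a)) (at-a n)) (≋-refl {d * W}) ⟩
      C + d * W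
        ≈⟨ +-≋ (≋-refl {C}) (*-≋ (≋-refl {d}) (⊠-↾ n v q)) ⟩
      C + d * (V * Q)
        ≡⟨ cong (C +_) (solve 4 (λ P u V Q → P :* u :* (V :* Q) := P :* Q :* (V :* u)) refl (p ^ e) u V Q) ⟩
      C + p ^ e * Q * (V * u)
        ≈⟨ +-≋ (≋-refl {C}) (*-≋ (≋-refl {p ^ e * Q}) (v⁻¹ n)) ⟩
      C + p ^ e * Q * 1
        ≡⟨ cong (C +_) (*-identityʳ (p ^ e * Q)) ⟩
      C + p ^ e * Q
        ≈⟨ ⊞⟦⟧⊠-↾ n ⟦ c ⟧ (p ^ e) q ⟨
      (⟦ c ⟧ ⊞ ⟦ p ^ e ⟧ ⊠ q) ↾ n
        ∎
      where
      open Mod n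
      open ≋-Reasoning
      d = p ^ e * u
      C = ⟦ c ⟧ ↾ n
      M = -1ₚ ↾ n
      W = w ↾ n
      V = v ↾ n
      Q = q ↾ n

  module Morphism {k : ℕ} (_⊕_ _⊗_ : Fin k → Fin k → Fin k) (φ : ℤₚ → Fin k)
                  (φ-cong : ∀ x y → x ≃ y → φ x ≡ φ y)
                  (φ-+ : ∀ x y → φ (x ⊞ y) ≡ φ x ⊕ φ y)
                  (φ-* : ∀ x y → φ (x ⊠ y) ≡ φ x ⊗ φ y) where

    φ-affine : ∀ {a b} → φ a ≡ φ b → ∀ s w → φ (s ⊞ a ⊠ w) ≡ φ (s ⊞ b ⊠ w)
    φ-affine {a} {b} φa≡φb s w = begin
      φ (s ⊞ a ⊠ w)        ≡⟨ φ-+ s (a ⊠ w) ⟩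
      φ s ⊕ φ (a ⊠ w)      ≡⟨ cong (φ s ⊕_) (φ-* a w) ⟩
      φ s ⊕ (φ a ⊗ φ w)    ≡⟨ cong (λ t → φ s ⊕ (t ⊗ φ w)) φa≡φb ⟩
      φ s ⊕ (φ b ⊗ φ w)    ≡⟨ cong (φ s ⊕_) (φ-* b w) ⟨
      φ s ⊕ φ (b ⊠ w)      ≡⟨ φ-+ s (b ⊠ w) ⟨
      φ (s ⊞ b ⊠ w)        ∎
      where open ≡-Reasoning

    collision : ∃₂ λ a d → 0 < d × φ ⟦ a ⟧ ≡ φ ⟦ a + d ⟧
    collision with i , j , i<j , φi≡φj ← pigeonhole (n<1+n k) (λ i → φ ⟦ toℕ i ⟧) =
      toℕ i , toℕ j ∸ toℕ i , m<n⇒0<n∸m i<j ,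
      trans φi≡φj (cong (λ t → φ ⟦ t ⟧) (sym (m+[n∸m]≡n (<⇒≤ i<j))))

    φ-↾ : ∀ {a u v} e → (∀ n → v ↾ n * u ≋[ n ] 1) → φ ⟦ a ⟧ ≡ φ ⟦ a + p ^ e * u ⟧ →
          ∀ x → φ x ≡ φ ⟦ x ↾ e ⟧
    φ-↾ {a} {u} e v⁻¹ φa≡φa+d x =
      let s , w , c≃ , x≃ = affine-pair v⁻¹ e a (x ↾ e) (shift e x) in begin
        φ x                            ≡⟨ φ-cong x x′ (expand e x) ⟩
        φ x′                           ≡⟨ φ-cong x′ (s ⊞ ⟦ a + p ^ e * u ⟧ ⊠ w) x≃ ⟩
        φ (s ⊞ ⟦ a + p ^ e * u ⟧ ⊠ w)  ≡⟨ φ-affine φa≡φa+d s w ⟨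
        φ (s ⊞ ⟦ a ⟧ ⊠ w)              ≡⟨ φ-cong ⟦ x ↾ e ⟧ (s ⊞ ⟦ a ⟧ ⊠ w) c≃ ⟨
        φ ⟦ x ↾ e ⟧                    ∎
      where
      open ≡-Reasoning
      x′ = ⟦ x ↾ e ⟧ ⊞ ⟦ p ^ e ⟧ ⊠ shift e x

    factors-through-↾ : Prime p → ∃ λ e → ∀ x y → x ↾ e ≡ y ↾ e → φ x ≡ φ y
    factors-through-↾ p-prime =
      let a , d , 0<d , φa≡φa+d = collision
          e , u , d≡pᵉu , p∤u = p-adic-decomposition (nonTrivial⇒n>1 p {{prime⇒nonTrivial p-prime}}) d 0<d
          v , v⁻¹ = unit-inverse (prime∤⇒coprime p-prime p∤u)
          φ-digits = φ-↾ e v⁻¹ (subst (λ t → φ ⟦ a ⟧ ≡ φ ⟦ a + t ⟧) d≡pᵉu φa≡φa+d)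
      in e , λ x y x↾e≡y↾e →
           trans (φ-digits x) (trans (cong (λ t → φ ⟦ t ⟧) x↾e≡y↾e) (sym (φ-digits y)))

  DependsOnDigits : ℕ → (ℤₚ → Set) → Set
  DependsOnDigits n X = ∀ x y → x ↾ n ≡ y ↾ n → X x → X y

  recognizable⇒dependsOnDigits : ∀ {X} → Prime p → Recognizable p X → ∃ λ n → DependsOnDigits n X
  recognizable⇒dependsOnDigits {X} p-prime R =
    saturation (Morphism.factors-through-↾ _⊕_ _⊗_ φ φ-wd φ-+ φ-* p-prime)
    where
    open Recognizable R
    saturation : (∃ λ n → ∀ x y → x ↾ n ≡ y ↾ n → φ x ≡ φ y) → ∃ λ n → DependsOnDigits n X
    saturation (n , φ-factors) = n , λ x y x↾n≡y↾n Xx →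
      Equivalence.from (saturated y) (x , Xx , φ-factors x y x↾n≡y↾n)

  dependsOnDigits⇒recognizable : ∀ {X} n → DependsOnDigits n X → Recognizable p X
  dependsOnDigits⇒recognizable {X} n dep = record
    { k = p ^ n ; _⊕_ = _⊕_ ; _⊗_ = _⊗_ ; φ = φ ; φ-wd = φ-cong ; φ-+ = φ-+ ; φ-* = φ-*
    ; φ-surj = φ-surj ; saturated = saturated
    }
    where
    instance _ = m^n≢0 p n

    _⊕_ _⊗_ : Fin (p ^ n) → Fin (p ^ n) → Fin (p ^ n)
    i ⊕ j = (toℕ i + toℕ j) mod p ^ n
    i ⊗ j = (toℕ i * toℕ j) mod p ^ n

    φ : ℤₚ → Fin (p ^ n)
    φ x = fromℕ< (↾-< n x)

    toℕ-φ : ∀ x → toℕ (φ x) ≡ x ↾ n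
    toℕ-φ x = toℕ-fromℕ< (↾-< n x)

    φ-injective : ∀ {x y} → φ x ≡ φ y → x ↾ n ≡ y ↾ n
    φ-injective {x} {y} φx≡φy = trans (sym (toℕ-φ x)) (trans (cong toℕ φx≡φy) (toℕ-φ y))

    φ-cong : ∀ x y → x ≃ y → φ x ≡ φ y
    φ-cong x y x≃y = toℕ-injective (trans (toℕ-φ x) (trans (↾-cong x≃y n) (sym (toℕ-φ y))))

    φ-mod : ∀ {x a} → x ↾ n ≋[ n ] a → φ x ≡ a mod p ^ n
    φ-mod {x} {a} x↾n≋a = toℕ-injective (begin
      toℕ (φ x)          ≡⟨ toℕ-φ x ⟩
      x ↾ n              ≡⟨ Mod.≋⇒≡ n (↾-< n x) (m%n<n a (p ^ n)) (Mod.≋-trans n x↾n≋a (Mod.≋-sym n (Mod.%-≋ n a))) ⟩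
      a % p ^ n          ≡⟨ toℕ-fromℕ< (m%n<n a (p ^ n)) ⟨
      toℕ (a mod p ^ n)  ∎)
      where open ≡-Reasoning

    φ-+ : ∀ x y → φ (x ⊞ y) ≡ φ x ⊕ φ y
    φ-+ x y = φ-mod (Mod.≋-trans n (⊞-↾ n x y) (Mod.≡⇒≋ n (sym (cong₂ _+_ (toℕ-φ x) (toℕ-φ y)))))

    φ-* : ∀ x y → φ (x ⊠ y) ≡ φ x ⊗ φ y
    φ-* x y = φ-mod (Mod.≋-trans n (⊠-↾ n x y) (Mod.≡⇒≋ n (sym (cong₂ _*_ (toℕ-φ x) (toℕ-φ y)))))

    φ-surj : ∀ i → ∃ λ x → φ x ≡ i
    φ-surj i = ⟦ toℕ i ⟧ , toℕ-injective (trans (toℕ-φ ⟦ toℕ i ⟧) (⟦⟧-↾-< n (toℕ<n i)))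

    saturated : ∀ y → X y ⇔ (∃ λ x → X x × φ x ≡ φ y)
    saturated y = mk⇔ (λ Xy → y , Xy , refl) (λ (x , Xx , φx≡φy) → dep x y (φ-injective φx≡φy) Xx)

  fPlusPowIdeal⇒dependsOnDigits : ∀ {X} n {F} → IsFPlusPowIdeal p X n F → DependsOnDigits n X
  fPlusPowIdeal⇒dependsOnDigits n X≡F+pⁿℤₚ x y x↾n≡y↾n Xx =
    let f , Ff , z , x≃ = Equivalence.to (X≡F+pⁿℤₚ x) Xx in
    Equivalence.from (X≡F+pⁿℤₚ y)
      (f , Ff , shift n y , expand-↾ n y (trans (sym x↾n≡y↾n) (↾-≃-expansion n x f z x≃)))

  dependsOnDigits⇒fPlusPowIdeal : ∀ {X} n → DependsOnDigits n X → IsFPlusPowIdeal p X n (λ f → X ⟦ toℕ f ⟧)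
  dependsOnDigits⇒fPlusPowIdeal {X} n dep y = mk⇔ to from
    where
    to : X y → ∃ λ f → X ⟦ toℕ f ⟧ × ∃ λ z → y ≃ ⟦ toℕ f ⟧ ⊞ ⟦ p ^ n ⟧ ⊠ z
    to Xy = f , dep y ⟦ toℕ f ⟧ (trans (sym (toℕ-fromℕ< (↾-< n y))) (sym (⟦⟧-↾-< n (toℕ<n f)))) Xy ,
            shift n y , expand-↾ n y (sym (toℕ-fromℕ< (↾-< n y)))
      where
      f : Fin (p ^ n)
      f = fromℕ< (↾-< n y)
    from : (∃ λ f → X ⟦ toℕ f ⟧ × ∃ λ z → y ≃ ⟦ toℕ f ⟧ ⊞ ⟦ p ^ n ⟧ ⊠ z) → X y
    from (f , Xf , z , y≃) = dep ⟦ toℕ f ⟧ y (trans (⟦⟧-↾-< n (toℕ<n f)) (sym (↾-≃-expansion n y f z y≃))) Xf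

proposition6p9 : (p : ℕ) .{{_ : NonZero p}} → Prime p →
    (X : Zp p → Set) → (∀ x y → _≈_ p x y → X x → X y) →
    Recognizable p X ⇔ (∃ λ n → Σ (Fin (p ^ n) → Set) λ F → IsFPlusPowIdeal p X n F)
-- The hypothesis that X respects ≈ is unused: each side of the equivalence already implies it.
proposition6p9 p p-prime X _ = mk⇔
  (λ R → let n , dep = recognizable⇒dependsOnDigits p-prime R in
         n , (λ f → X ⟦ toℕ f ⟧) , dependsOnDigits⇒fPlusPowIdeal n dep)
  (λ (n , F , X≡F+pⁿℤₚ) → dependsOnDigits⇒recognizable n (fPlusPowIdeal⇒dependsOnDigits n X≡F+pⁿℤₚ))
  where open PAdic p
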